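{- Let $T$ be a compressed monoidal signature. Every morphism in $\mathbf{SGraph}_T$ is arity-matching.
   Context: Graphs are finite directed multigraphs; $\mathbf{Graph}/\mathcal{G}$ is the slice category of graphs with a typing morphism to $\mathcal{G}$. A compressed monoidal signature $T = (O,M,\mathrm{dom},\mathrm{cod})$ consists of sets $O,M$ and functions $\mathrm{dom},\mathrm{cod} : M \rightarrow (O \times \{\mathsf{v},\mathsf{f}\})^*$ into finite lists. Its derived compressed typegraph $\mathcal{G}_T$ has vertex set $O \sqcup M$, a self-loop on each $X\in O$, for each $f\in M$ and index $i$ of $\mathrm{dom}(f)$ with $\mathrm{dom}(f)[i]=(X,a)$ an edge $\mathrm{in}^a_{f,i}$ from $X$ to $f$, and for each index $j$ of $\mathrm{cod}(f)$ with $\mathrm{cod}(f)[j]=(X,a)$ an edge $\mathrm{out}^a_{f,j}$ from $f$ to $X$. Vertices typed in $M$ are node-vertices, those typed in $O$ wire-vertices; an edge is fixed-arity if its type is tagged $\mathsf{f}$. A morphism $f$ of $\mathcal{G}_T$-typed graphs (including typing morphisms, with $\mathcal{G}_T$ typed by its identity) is arity-matching if for every node-vertex $v$ of its domain, $f$ restricts to a bijection from the fixed-arity edges incident to $v$ onto the fixed-arity edges incident to $f(v)$. A string graph is a finite $\mathcal{G}_T$-typed graph with arity-matching typing morphism in which every wire-vertex has at most one incoming and at most one outgoing edge; $\mathbf{SGraph}_T$ is the full subcategory of $\mathbf{Graph}/\mathcal{G}_T$ on string graphs. -}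

module Defs where

open import Data.Nat using (ℕ)
open import Data.Fin using (Fin)
open import Data.List using (List; length; lookup)
open import Data.Product using (Σ; ∃; _×_; _,_; proj₁; proj₂)
open import Data.Sum using (_⊎_; inj₁; inj₂)
open import Data.Maybe using (Maybe; just; nothing)
open import Relation.Binary.PropositionalEquality using (_≡_; refl)

record Graph : Set₁ where
  field
    V E : Set
    src tgt : E → V

record Hom (G H : Graph) : Set where
  private
    module G = Graph G
    module H = Graph H
  field
    hV : G.V → H.V
    hE : G.E → H.E
    src-comm : ∀ e → H.src (hE e) ≡ hV (G.src e)
    tgt-comm : ∀ e → H.tgt (hE e) ≡ hV (G.tgt e)

idHom : (G : Graph) → Hom G G
idHom G = record { hV = λ v → v ; hE = λ e → e ; src-comm = λ _ → refl ; tgt-comm = λ _ → refl }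

finGraph : (nV nE : ℕ) → (Fin nE → Fin nV) → (Fin nE → Fin nV) → Graph
finGraph nV nE s t = record { V = Fin nV ; E = Fin nE ; src = s ; tgt = t }

-- tags 𝗏 (variable arity) and 𝖿 (fixed arity)
data Tag : Set where
  𝗏 𝖿 : Tag

record Signature : Set₁ where
  field
    O M : Set
    dom cod : M → List (O × Tag)

module _ (T : Signature) where
  open Signature T

  data TEdge : Set where
    loop : O → TEdge
    inE  : (g : M) → Fin (length (dom g)) → TEdge
    outE : (g : M) → Fin (length (cod g)) → TEdge

  TSrc : TEdge → O ⊎ M
  TSrc (loop X)   = inj₁ X
  TSrc (inE g i)  = inj₁ (proj₁ (lookup (dom g) i))
  TSrc (outE g j) = inj₂ g

  TTgt : TEdge → O ⊎ M
  TTgt (loop X)   = inj₁ X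
  TTgt (inE g i)  = inj₂ g
  TTgt (outE g j) = inj₁ (proj₁ (lookup (cod g) j))

  tag : TEdge → Maybe Tag
  tag (loop X)   = nothing
  tag (inE g i)  = just (proj₂ (lookup (dom g) i))
  tag (outE g j) = just (proj₂ (lookup (cod g) j))

  𝒢 : Graph
  𝒢 = record { V = O ⊎ M ; E = TEdge ; src = TSrc ; tgt = TTgt }

record Typed (T : Signature) : Set₁ where
  field
    graph  : Graph
    typing : Hom graph (𝒢 T)

record TypedHom {T : Signature} (A B : Typed T) : Set where
  private
    module A = Typed A
    module B = Typed B
  field
    hom : Hom A.graph B.graph
  open Hom hom public
  field
    typV-comm : ∀ v → Hom.hV B.typing (hV v) ≡ Hom.hV A.typing v
    typE-comm : ∀ e → Hom.hE B.typing (hE e) ≡ Hom.hE A.typing e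

𝒢Typed : (T : Signature) → Typed T
𝒢Typed T = record { graph = 𝒢 T ; typing = idHom (𝒢 T) }

typingHom : {T : Signature} (A : Typed T) → TypedHom A (𝒢Typed T)
typingHom A = record { hom = Typed.typing A ; typV-comm = λ _ → refl ; typE-comm = λ _ → refl }

module _ {T : Signature} (A : Typed T) where
  open Signature T
  private
    module A = Typed A
    module AG = Graph A.graph

  IsNode : AG.V → Set
  IsNode v = ∃ λ (g : M) → Hom.hV A.typing v ≡ inj₂ g

  IsWire : AG.V → Set
  IsWire v = ∃ λ (X : O) → Hom.hV A.typing v ≡ inj₁ X

  IsFixed : AG.E → Set
  IsFixed e = tag T (Hom.hE A.typing e) ≡ just 𝖿

  Incident : AG.V → AG.E → Set
  Incident v e = (AG.src e ≡ v) ⊎ (AG.tgt e ≡ v)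

  FixedAt : AG.V → AG.E → Set
  FixedAt v e = Incident v e × IsFixed e

ArityMatching : {T : Signature} {A B : Typed T} → TypedHom A B → Set
ArityMatching {T} {A} {B} h =
  ∀ v → IsNode A v →
    (∀ e → FixedAt A v e → FixedAt B (hV v) (hE e))
    × (∀ e₁ e₂ → FixedAt A v e₁ → FixedAt A v e₂ → hE e₁ ≡ hE e₂ → e₁ ≡ e₂)
    × (∀ e′ → FixedAt B (hV v) e′ → ∃ λ e → FixedAt A v e × hE e ≡ e′)
  where open TypedHom h

mkTyped : {T : Signature} (nV nE : ℕ) (s t : Fin nE → Fin nV)
          → Hom (finGraph nV nE s t) (𝒢 T) → Typed T
mkTyped nV nE s t τ = record { graph = finGraph nV nE s t ; typing = τ }

record StringGraph (T : Signature) : Set₁ where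
  field
    nV nE   : ℕ
    src tgt : Fin nE → Fin nV
    typing  : Hom (finGraph nV nE src tgt) (𝒢 T)
  typed : Typed T
  typed = mkTyped nV nE src tgt typing
  field
    typing-arity : ArityMatching (typingHom typed)
    wire-in  : ∀ w → IsWire typed w → ∀ e₁ e₂ → tgt e₁ ≡ w → tgt e₂ ≡ w → e₁ ≡ e₂
    wire-out : ∀ w → IsWire typed w → ∀ e₁ e₂ → src e₁ ≡ w → src e₂ ≡ w → e₁ ≡ e₂

SGraphHom : {T : Signature} → StringGraph T → StringGraph T → Set
SGraphHom A B = TypedHom (StringGraph.typed A) (StringGraph.typed B)

module Submission where

-- A morphism h : A → B of 𝒢_T-typed graphs satisfies τ_B ∘ h = τ_A, where τ_A
-- and τ_B are the typing morphisms.  Any such h preserves node-vertices and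
-- maps fixed-arity edges at v to fixed-arity edges at h(v).  If τ_A is
-- arity-matching, h is injective on the fixed-arity edges at a node-vertex v,
-- since τ_A = τ_B ∘ h is.  If moreover τ_B is arity-matching, every
-- fixed-arity edge e′ at h(v) is hit: τ_B(e′) is a fixed-arity edge at
-- τ_A(v), so τ_A(e) = τ_B(e′) for some fixed-arity e at v, and h(e) = e′ by
-- injectivity of τ_B at h(v).  The theorem is the instance of this general
-- fact for string graphs, whose typings are arity-matching by definition.

open import Defs
open import Data.Product using (∃; _×_; _,_; proj₁; proj₂)
open import Data.Sum using (inj₁; inj₂)
open import Relation.Binary.PropositionalEquality using (_≡_; sym; trans; cong; subst)

module _ {T : Signature} {A B : Typed T} (h : TypedHom A B) where
  open TypedHom h
  private
    module τA = Hom (Typed.typing A)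
    module τB = Hom (Typed.typing B)

  node-preserved : ∀ v → IsNode A v → IsNode B (hV v)
  node-preserved v (g , τv≡g) = g , trans (typV-comm v) τv≡g

  fixedAt-preserved : ∀ v e → FixedAt A v e → FixedAt B (hV v) (hE e)
  fixedAt-preserved v e (incident , fixed) = preserve-incidence incident , preserve-tag
    where
    preserve-incidence : Incident A v e → Incident B (hV v) (hE e)
    preserve-incidence (inj₁ src≡v) = inj₁ (trans (src-comm e) (cong hV src≡v))
    preserve-incidence (inj₂ tgt≡v) = inj₂ (trans (tgt-comm e) (cong hV tgt≡v))

    preserve-tag : IsFixed B (hE e)
    preserve-tag = trans (cong (tag T) (typE-comm e)) fixed

  -- If τ_A is arity-matching, h is injective on the fixed-arity edges at a
  -- node-vertex: it is a first factor of the injective map τ_A = τ_B ∘ h.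
  fixedAt-injective : ArityMatching (typingHom A) →
    ∀ v → IsNode A v → ∀ e₁ e₂ → FixedAt A v e₁ → FixedAt A v e₂ → hE e₁ ≡ hE e₂ → e₁ ≡ e₂
  fixedAt-injective τA-arity v node e₁ e₂ fixed₁ fixed₂ h-eq =
    proj₁ (proj₂ (τA-arity v node)) e₁ e₂ fixed₁ fixed₂ τA-eq
    where
    τA-eq : τA.hE e₁ ≡ τA.hE e₂
    τA-eq = trans (sym (typE-comm e₁)) (trans (cong τB.hE h-eq) (typE-comm e₂))

  -- If both typings are arity-matching, h is onto the fixed-arity edges at
  -- h(v): lift τ_B(e′) along τ_A, then identify the lift's image with e′
  -- using injectivity of τ_B at h(v).
  fixedAt-surjective : ArityMatching (typingHom A) → ArityMatching (typingHom B) →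
    ∀ v → IsNode A v → ∀ e′ → FixedAt B (hV v) e′ → ∃ λ e → FixedAt A v e × hE e ≡ e′
  fixedAt-surjective τA-arity τB-arity v node e′ fixed′ = e , fixed , h-eq
    where
    τB-arity-at-hv : (∀ e → FixedAt B (hV v) e → FixedAt (𝒢Typed T) (τB.hV (hV v)) (τB.hE e))
                   × (∀ e₁ e₂ → FixedAt B (hV v) e₁ → FixedAt B (hV v) e₂ → τB.hE e₁ ≡ τB.hE e₂ → e₁ ≡ e₂)
                   × (∀ t → FixedAt (𝒢Typed T) (τB.hV (hV v)) t → ∃ λ e → FixedAt B (hV v) e × τB.hE e ≡ t)
    τB-arity-at-hv = τB-arity (hV v) (node-preserved v node)

    type-fixed-at-τv : FixedAt (𝒢Typed T) (τA.hV v) (τB.hE e′)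
    type-fixed-at-τv = subst (λ x → FixedAt (𝒢Typed T) x (τB.hE e′)) (typV-comm v)
                         (proj₁ τB-arity-at-hv e′ fixed′)

    lift : ∃ λ e → FixedAt A v e × τA.hE e ≡ τB.hE e′
    lift = proj₂ (proj₂ (τA-arity v node)) (τB.hE e′) type-fixed-at-τv

    e : Graph.E (Typed.graph A)
    e = proj₁ lift

    fixed : FixedAt A v e
    fixed = proj₁ (proj₂ lift)

    h-eq : hE e ≡ e′
    h-eq = proj₁ (proj₂ τB-arity-at-hv) (hE e) e′ (fixedAt-preserved v e fixed) fixed′
             (trans (typE-comm e) (proj₂ (proj₂ lift)))

  arityMatching-between-arityMatching : ArityMatching (typingHom A) → ArityMatching (typingHom B) →
    ArityMatching h
  arityMatching-between-arityMatching τA-arity τB-arity v node =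
    fixedAt-preserved v ,
    fixedAt-injective τA-arity v node ,
    fixedAt-surjective τA-arity τB-arity v node

proposition3p20 : (T : Signature) (A B : StringGraph T) (h : SGraphHom A B) → ArityMatching h
proposition3p20 T A B h =
  arityMatching-between-arityMatching h (StringGraph.typing-arity A) (StringGraph.typing-arity B)
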